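{- Let $2\le k<g$ be integers such that $Y(g,k)$ is nondegenerate. Then $Y(g,k)$ contains an odd pivot node other than $[0,0]$.
   Context: For integers $2\le k<g$, the labeled directed graph $H(g,k)$ has a distinguished starting node $[[0,0]]$ and other nodes labeled by pairs $[R,r]$ of integers with $0\le R,r\le k-1$ (the node $[0,0]$ is distinct from the starting node). For a node $[P,p]$ (the starting node treated as $[0,0]$ here) there is an edge labeled $(A,a)$ from $[P,p]$ to $[R,r]$ whenever $0\le A,a\le g-1$ are integers, $0\le R,r\le k-1$, $ka+p=A+rg$ and $kA+R=a+Pg$; edges leaving the starting node additionally require $A\ne0\ne a$; no edge enters the starting node. $H(g,k)$ consists of the starting node and all nodes reachable from it. An even pivot node is a node $[a,a]$; an odd pivot node is a node $[r,s]$ with an edge to $[s,r]$ (including $[a,a]$ with a self-loop); the starting node is not a pivot node. $Y(g,k)$ is obtained from $H(g,k)$ by deleting every node that is not a pivot node and from which no pivot node is reachable, with incident edges; it is nondegenerate if $H(g,k)$ contains at least one pivot node. -}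

module Defs where

open import Data.Nat using (ℕ; _+_; _*_; _<_)
open import Data.Product using (Σ; ∃; ∃-syntax; _×_; _,_)
open import Data.Sum using (_⊎_)
open import Relation.Binary.PropositionalEquality using (_≡_; _≢_)
open import Relation.Nullary using (¬_)
open import Data.Empty using (⊥)

-- Nodes of H(g,k): the distinguished starting node [[0,0]], or a pair [R,r].
-- (Range restriction 0 ≤ R,r ≤ k-1 is imposed on edges / reachability.)
data Node : Set where
  start : Node
  pair  : ℕ → ℕ → Node

fstN : Node → ℕ
fstN start      = 0
fstN (pair P p) = P

sndN : Node → ℕ
sndN start      = 0
sndN (pair P p) = p

EdgeLabel : (g k : ℕ) → Node → ℕ → ℕ → ℕ → ℕ → Set
EdgeLabel g k x A a R r =
  A < g × a < g × R < k × r < k ×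
  (k * a + sndN x ≡ A + r * g) ×
  (k * A + R ≡ a + fstN x * g) ×
  (x ≡ start → A ≢ 0 × a ≢ 0)

Edge : (g k : ℕ) → Node → Node → Set
Edge g k x start      = ⊥
Edge g k x (pair R r) = ∃[ A ] ∃[ a ] EdgeLabel g k x A a R r

data Path (g k : ℕ) : Node → Node → Set where
  here : ∀ {x} → Path g k x x
  step : ∀ {x y z} → Edge g k x y → Path g k y z → Path g k x z

InH : (g k : ℕ) → Node → Set
InH g k x = Path g k start x

EvenPivot : Node → Set
EvenPivot start      = ⊥
EvenPivot (pair R r) = R ≡ r

OddPivot : (g k : ℕ) → Node → Set
OddPivot g k start      = ⊥
OddPivot g k (pair r s) = Edge g k (pair r s) (pair s r)

Pivot : (g k : ℕ) → Node → Set
Pivot g k x = EvenPivot x ⊎ OddPivot g k x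

InY : (g k : ℕ) → Node → Set
InY g k x = InH g k x × (Pivot g k x ⊎ ∃[ y ] (Path g k x y × Pivot g k y))

Nondegenerate : (g k : ℕ) → Set
Nondegenerate g k = ∃[ x ] (InH g k x × Pivot g k x)

module Submission where

-- Reversal [P,p] ↦ [p,P] maps an edge x → [R,r] labelled
-- (A,a) to an edge [r,R] → [p,P] labelled (a,A).  Hence every path can be
-- walked backwards, and a pivot y always has a path y → reverse y.  Given a
-- pivot y in H, write its path from the start as start → [R,r] → … → y; then
--   start → [R,r] → … → y → reverse y → … → [r,R]
-- shows that [r,R] lies in H.  Adding the two equations of the first edge
-- (label (A,a)) gives, with c = a + A,
--   k·c + R = c + r·g,
-- which is exactly the equation of an edge [r,R] → [R,r] labelled (c,c).
-- If c < g this makes [r,R] an odd pivot, and [r,R] ≠ [0,0] because a ≠ 0.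
-- Otherwise c = g, R = 0, r = k-1 and g = (k+1)·A, and then [k-1,k-1], which is
-- always an odd pivot, is reached from [0,k-1] by an explicit edge.

open import Defs
open import Data.Nat using (ℕ; _≤_; _<_; zero; suc; _+_; _*_; s≤s; z≤n; _<?_; >-nonZero)
open import Data.Nat.Properties
open import Data.Nat.Tactic.RingSolver using (solve-∀)
open import Data.Product using (∃-syntax; _×_; _,_; proj₁; proj₂)
open import Data.Sum using (inj₁; inj₂)
open import Relation.Nullary using (yes; no)
open import Data.Empty using (⊥-elim)
open import Relation.Binary.PropositionalEquality

OddPivotWitness : ℕ → ℕ → Set
OddPivotWitness g k = ∃[ x ] (InY g k x × OddPivot g k x × x ≢ pair 0 0)

oddPivotWitness : ∀ {g k x} → InH g k x → OddPivot g k x → x ≢ pair 0 0 →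
  OddPivotWitness g k
oddPivotWitness {x = x} inH odd x≢00 = x , (inH , inj₁ (inj₂ odd)) , odd , x≢00

reverse : Node → Node
reverse x = pair (sndN x) (fstN x)

Bounded : ℕ → Node → Set
Bounded k x = fstN x < k × sndN x < k

targetBounded : ∀ {g k x R r} → Edge g k x (pair R r) → Bounded k (pair R r)
targetBounded (_ , _ , _ , _ , R<k , r<k , _) = R<k , r<k

-- Swapping the label (A,a) to (a,A) swaps the two edge equations, so the
-- edge x → [R,r] yields the edge [r,R] → reverse x.
reverseEdge : ∀ {g k x R r} → Bounded k x → Edge g k x (pair R r) →
  Edge g k (pair r R) (reverse x)
reverseEdge (P<k , p<k) (A , a , A<g , a<g , _ , _ , eq₁ , eq₂ , _) =
  a , A , a<g , A<g , p<k , P<k , eq₂ , eq₁ , λ ()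

_++ₚ_ : ∀ {g k x y z} → Path g k x y → Path g k y z → Path g k x z
here       ++ₚ q = q
step e p   ++ₚ q = step e (p ++ₚ q)

reversePath : ∀ {g k x y} → Bounded k x → Path g k x y →
  Path g k (reverse y) (reverse x)
reversePath bx here = here
reversePath bx (step {y = start} () p)
reversePath bx (step {y = pair R r} e p) =
  reversePath (targetBounded e) p ++ₚ step (reverseEdge bx e) here

pivotToReverse : ∀ {g k y} → Pivot g k y → Path g k y (reverse y)
pivotToReverse {y = start}    (inj₁ ())
pivotToReverse {y = start}    (inj₂ ())
pivotToReverse {y = pair R r} (inj₁ refl) = here
pivotToReverse {y = pair R r} (inj₂ e)    = step e here

reflectedEntry : ∀ {g k} → Nondegenerate g k →
  ∃[ R ] ∃[ r ] ∃[ A ] ∃[ a ] (EdgeLabel g k start A a R r × InH g k (pair r R))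
reflectedEntry (start , here , inj₁ ())
reflectedEntry (start , here , inj₂ ())
reflectedEntry (y , step {y = start} () p , pivot)
reflectedEntry (y , step {y = pair R r} e@(A , a , label) p , pivot) =
  R , r , A , a , label ,
  step e (p ++ₚ (pivotToReverse pivot ++ₚ reversePath (targetBounded e) p))

startLabelSum : ∀ g k A a R r → k * a + 0 ≡ A + r * g → k * A + R ≡ a + 0 →
  k * (a + A) + R ≡ (a + A) + r * g
startLabelSum g k A a R r eq₁ eq₂ = begin
  k * (a + A) + R                 ≡⟨ split k a A R ⟩
  (k * a + 0) + (k * A + R)       ≡⟨ cong₂ _+_ eq₁ eq₂ ⟩
  (A + r * g) + (a + 0)           ≡⟨ regroup A r g a ⟩
  (a + A) + r * g                 ∎
  where
  open ≡-Reasoning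
  split : ∀ k a A R → k * (a + A) + R ≡ (k * a + 0) + (k * A + R)
  split = solve-∀
  regroup : ∀ A r g a → (A + r * g) + (a + 0) ≡ (a + A) + r * g
  regroup = solve-∀

diagonalOddPivot : ∀ {g k} c R r → c < g → R < k → r < k →
  k * c + R ≡ c + r * g → OddPivot g k (pair r R)
diagonalOddPivot c R r c<g R<k r<k eq = c , c , c<g , c<g , R<k , r<k , eq , eq , λ ()

fixedByMultiple : ∀ n c → suc (suc n) * c + 0 ≡ c + 0 → c ≡ 0
fixedByMultiple n c eq =
  m+n≡0⇒m≡0 c (m+n≡0⇒m≡0 (suc n * c) (+-cancelˡ-≡ c _ 0 (begin
    c + (suc n * c + 0)   ≡⟨ +-assoc c (suc n * c) 0 ⟨
    suc (suc n) * c + 0   ≡⟨ eq ⟩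
    c + 0                 ∎)))
  where open ≡-Reasoning

largeDiagonal : ∀ m g c R r → 1 ≤ m → 1 ≤ g → r ≤ m → g ≤ c →
  suc m * c + R ≡ c + r * g → R ≡ 0 × r ≡ m × c ≡ g
largeDiagonal m g c R r 1≤m 1≤g r≤m g≤c eq = R≡0 , r≡m , c≡g
  where
  open ≤-Reasoning
  reduced : m * c + R ≡ r * g
  reduced = +-cancelˡ-≡ c _ _ (trans (sym (+-assoc c (m * c) R)) eq)
  squeeze : m * g + R ≤ m * g + 0
  squeeze = begin
    m * g + R   ≤⟨ +-monoˡ-≤ R (*-monoʳ-≤ m g≤c) ⟩
    m * c + R   ≡⟨ reduced ⟩
    r * g       ≤⟨ *-monoˡ-≤ g r≤m ⟩
    m * g       ≡⟨ +-identityʳ _ ⟨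
    m * g + 0   ∎
  R≡0 : R ≡ 0
  R≡0 = n≤0⇒n≡0 (+-cancelˡ-≤ (m * g) R 0 squeeze)
  mc≡rg : m * c ≡ r * g
  mc≡rg = trans (sym (+-identityʳ _)) (trans (cong (m * c +_) (sym R≡0)) reduced)
  c≡g : c ≡ g
  c≡g = ≤-antisym (*-cancelˡ-≤ m {{>-nonZero 1≤m}} (begin
    m * c  ≡⟨ mc≡rg ⟩
    r * g  ≤⟨ *-monoˡ-≤ g r≤m ⟩
    m * g  ∎)) g≤c
  r≡m : r ≡ m
  r≡m = *-cancelʳ-≡ r m g {{>-nonZero 1≤g}} (trans (sym mc≡rg) (cong (m *_) c≡g))

cornerOddPivot : ∀ m g₀ → OddPivot (suc g₀) (suc m) (pair m m)
cornerOddPivot m g₀ = g₀ , g₀ , ≤-refl , ≤-refl , ≤-refl , ≤-refl , loop m g₀ , loop m g₀ , λ ()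
  where
  loop : ∀ m g₀ → suc m * g₀ + m ≡ g₀ + m * suc g₀
  loop = solve-∀

cornerEdge : ∀ m A₀ → Edge (suc m * suc A₀ + suc A₀) (suc m) (pair 0 m) (pair m m)
cornerEdge m A₀ = A₀ , suc m * A₀ + m , A₀<g , a<g , ≤-refl , ≤-refl ,
  first m A₀ , sym (+-identityʳ _) , λ ()
  where
  first : ∀ m A₀ → suc m * (suc m * A₀ + m) + m ≡ A₀ + m * (suc m * suc A₀ + suc A₀)
  first = solve-∀
  unfold : ∀ m A₀ → suc m * suc A₀ + suc A₀ ≡ suc (suc m * A₀ + m) + suc A₀
  unfold = solve-∀
  a<g : suc m * A₀ + m < suc m * suc A₀ + suc A₀
  a<g = ≤-trans (m≤m+n _ (suc A₀)) (≤-reflexive (sym (unfold m A₀)))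
  A₀<g : A₀ < suc m * suc A₀ + suc A₀
  A₀<g = m≤n+m (suc A₀) (suc m * suc A₀)

cornerFromEntry : ∀ {g} m A₀ → g ≡ suc m * suc A₀ + suc A₀ →
  InH g (suc m) (pair 0 m) → InH g (suc m) (pair m m)
cornerFromEntry m A₀ refl entry = entry ++ₚ step (cornerEdge m A₀) here

entryModulus : ∀ k A a g → k * A + 0 ≡ a + 0 → a + A ≡ g → g ≡ k * A + A
entryModulus k A a g eq sum = begin
  g          ≡⟨ sum ⟨
  a + A      ≡⟨ cong (_+ A) (+-cancelʳ-≡ 0 a (k * A) (sym eq)) ⟩
  k * A + A  ∎
  where open ≡-Reasoning

-- In the large case the entry edge is start → [0,k-1] with label sum g; its
-- label is nonzero, so g = (k+1)·A with A ≥ 1 and the corner is reached.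
cornerReachable : ∀ {g} m A a → EdgeLabel g (suc m) start A a 0 m → a + A ≡ g →
  InH g (suc m) (pair m m)
cornerReachable m zero a (_ , _ , _ , _ , _ , _ , nonzero) sum =
  ⊥-elim (proj₁ (nonzero refl) refl)
cornerReachable {g} m (suc A₀) a label@(_ , _ , _ , _ , _ , eq₂ , _) sum =
  cornerFromEntry m A₀ (entryModulus (suc m) (suc A₀) a g eq₂ sum)
                  (step (suc A₀ , a , label) here)

-- The corollary: split on whether the summed label c = a + A of the entry edge
-- is below g.  (k < g only serves to make g nonzero.)
corollary3 : (g k : ℕ) → 2 ≤ k → k < g → Nondegenerate g k →
    ∃[ x ] (InY g k x × OddPivot g k x × x ≢ pair 0 0)
corollary3 (suc g₀) (suc (suc n)) (s≤s (s≤s z≤n)) _ nondeg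
  with reflectedEntry nondeg
... | R , r , A , a , label@(_ , _ , R<k , r<k , eq₁ , eq₂ , nonzero) , reflected
  with a + A <? suc g₀
      | startLabelSum (suc g₀) (suc (suc n)) A a R r eq₁ eq₂
... | yes small | diagonal =
  oddPivotWitness reflected (diagonalOddPivot (a + A) R r small R<k r<k diagonal) notOrigin
  where
  notOrigin : pair r R ≢ pair 0 0
  notOrigin refl = proj₂ (nonzero refl) (m+n≡0⇒m≡0 a (fixedByMultiple n (a + A) diagonal))
... | no large | diagonal
  with largeDiagonal (suc n) (suc g₀) (a + A) R r (s≤s z≤n) (s≤s z≤n) (≤-pred r<k) (≮⇒≥ large) diagonal
... | refl , refl , sum =
  oddPivotWitness (cornerReachable (suc n) A a label sum) (cornerOddPivot (suc n) g₀) (λ ())
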